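{- Let $k\ge 3$ be fixed. For each sufficiently large $n$ with $n\equiv 1 \pmod{2k}$, let $\mathcal{C}$ be a decomposition of the edge set of the complete graph $K_n$ into pairwise edge-disjoint copies of the undirected cycle $C_k$, and let $T$ be the random tournament obtained by orienting each member of $\mathcal{C}$ as a directed $k$-cycle, choosing one of its two cyclic directions uniformly at random, independently for different members. Then, with probability tending to $1$ as $n\to\infty$, for every pair of disjoint vertex sets $A,B$ of $T$ with $|A|,|B|\ge n^{2/3}$, both $e(A,B)$ and $e(B,A)$ are at most $(1+o_n(1))|A||B|/2$, where $o_n(1)$ is a quantity tending to $0$ as $n\to\infty$ (uniformly over all such pairs $A,B$).
   Context: $e(A,B)$ denotes the number of arcs of $T$ going from a vertex of $A$ to a vertex of $B$. A tournament is an orientation of a complete graph. -}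

module Defs where

open import Data.Nat using (ℕ; zero; suc; _+_; _*_; _≤_; _<_; _≤ᵇ_)
open import Data.Nat.DivMod using (_%_; m%n<n)
open import Data.Bool using (Bool; true; false; _∧_; _∨_; not; if_then_else_)
open import Data.Fin using (Fin; zero; suc; toℕ; fromℕ<; _≟_)
open import Data.Fin.Subset using (Subset; inside; outside; ∣_∣; _∈_; _∉_)
open import Data.Fin.Subset.Properties using (_∈?_)
open import Data.Vec using (Vec; []; _∷_)
open import Data.Product using (_×_)
open import Function using (_∘_)
open import Function.Definitions using (Injective)
open import Relation.Binary.PropositionalEquality using (_≡_; _≢_)
open import Relation.Nullary.Decidable using (⌊_⌋)

cnext : ∀ {k} → Fin k → Fin k
cnext {suc k} i = fromℕ< (m%n<n (suc (toℕ i)) (suc k))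

_==_ : ∀ {n} → Fin n → Fin n → Bool
u == v = ⌊ u ≟ v ⌋

countFin : ∀ {n} → (Fin n → Bool) → ℕ
countFin {zero}  f = 0
countFin {suc n} f = (if f zero then 1 else 0) + countFin (f ∘ suc)

sumFin : ∀ {n} → (Fin n → ℕ) → ℕ
sumFin {zero}  f = 0
sumFin {suc n} f = f zero + sumFin (f ∘ suc)

anyFin : ∀ {n} → (Fin n → Bool) → Bool
anyFin {zero}  f = false
anyFin {suc n} f = f zero ∨ anyFin (f ∘ suc)

allSubsets : ∀ n → (Subset n → Bool) → Bool
allSubsets zero    f = f []
allSubsets (suc n) f = allSubsets n (λ s → f (inside ∷ s)) ∧ allSubsets n (λ s → f (outside ∷ s))

-- number of functions σ : Fin m → Bool satisfying a boolean predicate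
-- (i.e. 2^m times the probability under the uniform measure)
countAssignments : ∀ m → ((Fin m → Bool) → Bool) → ℕ
countAssignments zero    P = if P (λ ()) then 1 else 0
countAssignments (suc m) P =
  countAssignments m (λ σ → P (λ { zero → true ; (suc j) → σ j }))
  + countAssignments m (λ σ → P (λ { zero → false ; (suc j) → σ j }))

-- A family of m cycles of length k in K_n:  C j i is the i-th vertex of the j-th cycle;
-- the edges of cycle j are {C j i , C j (cnext i)}.
edgeIs : ∀ {n} → Fin n → Fin n → Fin n → Fin n → Bool
edgeIs a b u v = (a == u ∧ b == v) ∨ (a == v ∧ b == u)

IsCkDecomposition : ∀ {n k m} → (Fin m → Fin k → Fin n) → Set
IsCkDecomposition {n} {k} {m} C =
  (∀ j → Injective _≡_ _≡_ (C j)) ×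
  (∀ (u v : Fin n) → u ≢ v →
     sumFin (λ j → countFin (λ i → edgeIs (C j i) (C j (cnext i)) u v)) ≡ 1)

arc : ∀ {n k m} → (Fin m → Fin k → Fin n) → (Fin m → Bool) → Fin n → Fin n → Bool
arc C σ u v = anyFin (λ j → anyFin (λ i →
  if σ j then (C j i == u ∧ C j (cnext i) == v)
         else (C j (cnext i) == u ∧ C j i == v)))

e : ∀ {n k m} → (Fin m → Fin k → Fin n) → (Fin m → Bool) → Subset n → Subset n → ℕ
e C σ A B = sumFin (λ u → countFin (λ v → ⌊ u ∈? A ⌋ ∧ ⌊ v ∈? B ⌋ ∧ arc C σ u v))

disjointB : ∀ {n} → Subset n → Subset n → Bool
disjointB A B = not (anyFin (λ x → ⌊ x ∈? A ⌋ ∧ ⌊ x ∈? B ⌋))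

-- |A| ≥ n^{2/3}  ⟺  |A|^3 ≥ n^2  (|A| an integer)
largeB : ∀ {n} → Subset n → Bool
largeB {n} A = (n * n) ≤ᵇ (∣ A ∣ * ∣ A ∣ * ∣ A ∣)

-- With ε = p/q: the pair (A,B) violates  e(A,B), e(B,A) ≤ (1+ε)|A||B|/2,
-- i.e. 2 q e(X,Y) ≤ (q+p)|A||B|.
violates : ∀ {n k m} → (Fin m → Fin k → Fin n) → (Fin m → Bool) → ℕ → ℕ → Subset n → Subset n → Bool
violates C σ p q A B =
  not ((2 * q * e C σ A B) ≤ᵇ ((q + p) * ∣ A ∣ * ∣ B ∣))
  ∨ not ((2 * q * e C σ B A) ≤ᵇ ((q + p) * ∣ A ∣ * ∣ B ∣))

badOrientation : ∀ {n k m} → (Fin m → Fin k → Fin n) → ℕ → ℕ → (Fin m → Bool) → Bool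
badOrientation {n} C p q σ =
  not (allSubsets n (λ A → allSubsets n (λ B →
    not (disjointB A B ∧ largeB A ∧ largeB B ∧ violates C σ p q A B))))

badCount : ∀ {n k m} → (Fin m → Fin k → Fin n) → ℕ → ℕ → ℕ
badCount {m = m} C p q = countAssignments m (badOrientation C p q)

module Submission where

-- Fix disjoint A, B and a position i on the cycles.  Orienting cycle j decides whether its i-th edge, if it
-- joins A and B, becomes an arc A → B or B → A; these are independent fair coins, so the number Z_i of arcs
-- A → B in position i satisfies E[(K+2)^Z_i K^(S_i − Z_i)] = (K+1)^S_i, where S_i counts the i-th edges
-- between A and B.  As every edge of K_n lies in exactly one cycle, e(A,B) ≤ Σ_i Z_i and Σ_i S_i ≤ |A||B|,
-- so e(A,B) > (1 + p/q)|A||B|/2 forces Z_i − S_i/2 > p|A||B|/(2kq) for some i.  With K = kq, Markov's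
-- inequality bounds the proportion of such orientations by 1/(4^n·2kq) once |A||B| ≥ n^(4/3) is large,
-- which pays for the union bound over the 4^n pairs (A, B), the two directions and the k positions.


open import Defs
open import Data.Nat using (ℕ; suc; _+_; _*_; _^_; _≤_)
open import Data.Fin using (Fin)
open import Data.Product using (∃-syntax)
open import Relation.Binary.PropositionalEquality using (_≡_)

open import Data.Nat hiding (_≟_)
open import Data.Nat.Properties hiding (_≟_)
open import Data.Nat.Tactic.RingSolver
open import Data.Bool using (Bool; true; false; _∧_; _∨_; not; if_then_else_; T)
open import Data.Bool.Properties using (∧-identityʳ; ∧-zeroʳ; ∧-assoc; ∧-comm; ∨-comm; not-involutive; T-∧; T-∨)
open import Data.Empty using (⊥; ⊥-elim)
open import Data.Fin using (zero; suc; _≟_)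
open import Data.Fin.Subset using (Subset; inside; outside; ∣_∣)
open import Data.Fin.Subset.Properties using (_∈?_)
open import Data.Product using (_×_; _,_; proj₁; proj₂)
open import Data.Sum using (_⊎_; inj₁; inj₂; [_,_]′)
open import Data.Unit using (tt)
open import Data.Vec using ([]; _∷_)
open import Function using (_∘_)
open import Function.Bundles using (Equivalence)
open import Relation.Binary.PropositionalEquality
open import Relation.Nullary using (¬_)
open import Relation.Nullary.Decidable using (⌊_⌋; yes; no; T?)

-- Indicators and sums over Fin

⟦_⟧ : Bool → ℕ
⟦ b ⟧ = if b then 1 else 0

⟦∧⟧ : ∀ a b → ⟦ a ∧ b ⟧ ≡ ⟦ a ⟧ * ⟦ b ⟧
⟦∧⟧ true  true  = refl
⟦∧⟧ true  false = refl
⟦∧⟧ false b     = refl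

T-not⇒¬T : ∀ {b} → T (not b) → ¬ T b
T-not⇒¬T {false} _ ()

¬T-not⇒T : ∀ {b} → ¬ T (not b) → T b
¬T-not⇒T {true}  _   = tt
¬T-not⇒T {false} ¬Tb = ⊥-elim (¬Tb tt)

T-not-≤ᵇ⇒> : ∀ {a b} → T (not (a ≤ᵇ b)) → b < a
T-not-≤ᵇ⇒> a≰ᵇb = ≰⇒> (T-not⇒¬T a≰ᵇb ∘ ≤⇒≤ᵇ)

¬T-not-≤ᵇ⇒≤ : ∀ {a b} → ¬ T (not (a ≤ᵇ b)) → a ≤ b
¬T-not-≤ᵇ⇒≤ {a} {b} ¬a≰ᵇb = ≤ᵇ⇒≤ a b (¬T-not⇒T ¬a≰ᵇb)

¬T-anyFin : ∀ {n} (f : Fin n → Bool) → ¬ T (anyFin f) → ∀ x → ¬ T (f x)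
¬T-anyFin f none zero fx with f zero
... | true  = none tt
... | false = fx
¬T-anyFin f none (suc x) fx with f zero
... | true  = none tt
... | false = ¬T-anyFin (f ∘ suc) none x fx

anyFin-cong : ∀ {n} {f g : Fin n → Bool} → (∀ x → f x ≡ g x) → anyFin f ≡ anyFin g
anyFin-cong {zero}  f≗g = refl
anyFin-cong {suc n} f≗g = cong₂ _∨_ (f≗g zero) (anyFin-cong (f≗g ∘ suc))

sumFin-cong : ∀ {n} {f g : Fin n → ℕ} → (∀ x → f x ≡ g x) → sumFin f ≡ sumFin g
sumFin-cong {zero}  f≗g = refl
sumFin-cong {suc n} f≗g = cong₂ _+_ (f≗g zero) (sumFin-cong (f≗g ∘ suc))

sumFin-mono : ∀ {n} {f g : Fin n → ℕ} → (∀ x → f x ≤ g x) → sumFin f ≤ sumFin g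
sumFin-mono {zero}  f≤g = ≤-refl
sumFin-mono {suc n} f≤g = +-mono-≤ (f≤g zero) (sumFin-mono (f≤g ∘ suc))

sumFin-+ : ∀ {n} (f g : Fin n → ℕ) → sumFin (λ x → f x + g x) ≡ sumFin f + sumFin g
sumFin-+ {zero}  f g = refl
sumFin-+ {suc n} f g = trans (cong (f zero + g zero +_) (sumFin-+ (f ∘ suc) (g ∘ suc)))
                             (interchange (f zero) (g zero) _ _)
  where
  interchange : ∀ a b c d → a + b + (c + d) ≡ a + c + (b + d)
  interchange = solve-∀

sumFin-*ˡ : ∀ {n} c (f : Fin n → ℕ) → sumFin (λ x → c * f x) ≡ c * sumFin f
sumFin-*ˡ {zero}  c f = sym (*-zeroʳ c)
sumFin-*ˡ {suc n} c f = trans (cong (c * f zero +_) (sumFin-*ˡ c (f ∘ suc))) (sym (*-distribˡ-+ c (f zero) _))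

sumFin-const : ∀ n c → sumFin {n} (λ _ → c) ≡ n * c
sumFin-const zero    c = refl
sumFin-const (suc n) c = cong (c +_) (sumFin-const n c)

sumFin-zero : ∀ {n} {f : Fin n → ℕ} → (∀ x → f x ≡ 0) → sumFin f ≡ 0
sumFin-zero {n} f≗0 = trans (sumFin-cong f≗0) (trans (sumFin-const n 0) (*-zeroʳ n))

sumFin-swap : ∀ {n m} (f : Fin n → Fin m → ℕ) →
  sumFin (λ a → sumFin (λ b → f a b)) ≡ sumFin (λ b → sumFin (λ a → f a b))
sumFin-swap {zero} {m} f = sym (sumFin-zero {m} (λ _ → refl))
sumFin-swap {suc n} f = trans (cong (sumFin (f zero) +_) (sumFin-swap (f ∘ suc)))
                              (sym (sumFin-+ (f zero) (λ b → sumFin (λ a → f (suc a) b))))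

sumFin-swap₂ : ∀ {a b c d} (f : Fin a → Fin b → Fin c → Fin d → ℕ) →
  sumFin (λ w → sumFin (λ x → sumFin (λ y → sumFin (λ z → f w x y z)))) ≡
  sumFin (λ y → sumFin (λ z → sumFin (λ w → sumFin (λ x → f w x y z))))
sumFin-swap₂ f = begin
  sumFin (λ w → sumFin (λ x → sumFin (λ y → sumFin (λ z → f w x y z))))
    ≡⟨ sumFin-cong (λ w → sumFin-swap (λ x y → sumFin (λ z → f w x y z))) ⟩
  sumFin (λ w → sumFin (λ y → sumFin (λ x → sumFin (λ z → f w x y z))))
    ≡⟨ sumFin-swap (λ w y → sumFin (λ x → sumFin (λ z → f w x y z))) ⟩
  sumFin (λ y → sumFin (λ w → sumFin (λ x → sumFin (λ z → f w x y z))))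
    ≡⟨ sumFin-cong (λ y → sumFin-cong (λ w → sumFin-swap (λ x z → f w x y z))) ⟩
  sumFin (λ y → sumFin (λ w → sumFin (λ z → sumFin (λ x → f w x y z))))
    ≡⟨ sumFin-cong (λ y → sumFin-swap (λ w z → sumFin (λ x → f w x y z))) ⟩
  sumFin (λ y → sumFin (λ z → sumFin (λ w → sumFin (λ x → f w x y z)))) ∎
  where open ≡-Reasoning

sumFin-*-sumFin : ∀ {a b} (f : Fin a → ℕ) (g : Fin b → ℕ) →
  sumFin (λ u → sumFin (λ v → f u * g v)) ≡ sumFin f * sumFin g
sumFin-*-sumFin f g = begin
  sumFin (λ u → sumFin (λ v → f u * g v))  ≡⟨ sumFin-cong (λ u → sumFin-*ˡ (f u) g) ⟩
  sumFin (λ u → f u * sumFin g)            ≡⟨ sumFin-cong (λ u → *-comm (f u) (sumFin g)) ⟩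
  sumFin (λ u → sumFin g * f u)            ≡⟨ sumFin-*ˡ (sumFin g) f ⟩
  sumFin g * sumFin f                      ≡⟨ *-comm (sumFin g) (sumFin f) ⟩
  sumFin f * sumFin g                      ∎
  where open ≡-Reasoning

f≤sumFin : ∀ {n} (f : Fin n → ℕ) x → f x ≤ sumFin f
f≤sumFin f zero    = m≤m+n _ _
f≤sumFin f (suc x) = ≤-trans (f≤sumFin (f ∘ suc) x) (m≤n+m _ _)

countFin≡sumFin : ∀ {n} (f : Fin n → Bool) → countFin f ≡ sumFin (⟦_⟧ ∘ f)
countFin≡sumFin {zero}  f = refl
countFin≡sumFin {suc n} f = cong (⟦ f zero ⟧ +_) (countFin≡sumFin (f ∘ suc))

∈?-suc : ∀ {n} (u : Fin n) s (A : Subset n) → ⌊ suc u ∈? (s ∷ A) ⌋ ≡ ⌊ u ∈? A ⌋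
∈?-suc u s A with u ∈? A
... | yes _ = refl
... | no _  = refl

∣A∣≡sumFin : ∀ {n} (A : Subset n) → ∣ A ∣ ≡ sumFin (λ u → ⟦ ⌊ u ∈? A ⌋ ⟧)
∣A∣≡sumFin []            = refl
∣A∣≡sumFin (inside ∷ A)  = cong suc (trans (∣A∣≡sumFin A) (sumFin-cong (λ u → cong ⟦_⟧ (sym (∈?-suc u inside A)))))
∣A∣≡sumFin (outside ∷ A) = trans (∣A∣≡sumFin A) (sumFin-cong (λ u → cong ⟦_⟧ (sym (∈?-suc u outside A))))

==-suc : ∀ {n} (a b : Fin n) → (suc a == suc b) ≡ (a == b)
==-suc a b with a ≟ b
... | yes _ = refl
... | no _  = refl

sumFin-delta : ∀ {n} (P : Fin n → Bool) a → sumFin (λ u → ⟦ P u ∧ (a == u) ⟧) ≡ ⟦ P a ⟧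
sumFin-delta P zero = begin
  ⟦ P zero ∧ true ⟧ + sumFin (λ u → ⟦ P (suc u) ∧ false ⟧)  ≡⟨ cong₂ _+_ (cong ⟦_⟧ (∧-identityʳ (P zero)))
                                                                      (sumFin-zero (λ u → cong ⟦_⟧ (∧-zeroʳ (P (suc u))))) ⟩
  ⟦ P zero ⟧ + 0                                             ≡⟨ +-identityʳ ⟦ P zero ⟧ ⟩
  ⟦ P zero ⟧                                                 ∎
  where open ≡-Reasoning
sumFin-delta P (suc a) = begin
  ⟦ P zero ∧ false ⟧ + sumFin (λ u → ⟦ P (suc u) ∧ (suc a == suc u) ⟧)
    ≡⟨ cong₂ _+_ (cong ⟦_⟧ (∧-zeroʳ (P zero))) (sumFin-cong (λ u → cong (λ b → ⟦ P (suc u) ∧ b ⟧) (==-suc a u))) ⟩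
  sumFin (λ u → ⟦ P (suc u) ∧ (a == u) ⟧)
    ≡⟨ sumFin-delta (P ∘ suc) a ⟩
  ⟦ P (suc a) ⟧ ∎
  where open ≡-Reasoning

sumFin²-delta : ∀ {n} (P Q : Fin n → Bool) a b →
  sumFin (λ u → sumFin (λ v → ⟦ (P u ∧ Q v) ∧ ((a == u) ∧ (b == v)) ⟧)) ≡ ⟦ P a ∧ Q b ⟧
sumFin²-delta P Q a b = begin
  sumFin (λ u → sumFin (λ v → ⟦ (P u ∧ Q v) ∧ ((a == u) ∧ (b == v)) ⟧))
    ≡⟨ sumFin-cong (λ u → sumFin-cong (λ v → factor (P u) (Q v) (a == u) (b == v))) ⟩
  sumFin (λ u → sumFin (λ v → ⟦ P u ∧ (a == u) ⟧ * ⟦ Q v ∧ (b == v) ⟧))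
    ≡⟨ sumFin-*-sumFin (λ u → ⟦ P u ∧ (a == u) ⟧) (λ v → ⟦ Q v ∧ (b == v) ⟧) ⟩
  sumFin (λ u → ⟦ P u ∧ (a == u) ⟧) * sumFin (λ v → ⟦ Q v ∧ (b == v) ⟧)
    ≡⟨ cong₂ _*_ (sumFin-delta P a) (sumFin-delta Q b) ⟩
  ⟦ P a ⟧ * ⟦ Q b ⟧
    ≡⟨ ⟦∧⟧ (P a) (Q b) ⟨
  ⟦ P a ∧ Q b ⟧ ∎
  where
  open ≡-Reasoning
  interchange : ∀ p q r t → (p ∧ q) ∧ (r ∧ t) ≡ (p ∧ r) ∧ (q ∧ t)
  interchange false q     r t = refl
  interchange true  false r t = sym (∧-zeroʳ r)
  interchange true  true  r t = refl
  factor : ∀ p q r t → ⟦ (p ∧ q) ∧ (r ∧ t) ⟧ ≡ ⟦ p ∧ r ⟧ * ⟦ q ∧ t ⟧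
  factor p q r t = begin
    ⟦ (p ∧ q) ∧ (r ∧ t) ⟧   ≡⟨ cong ⟦_⟧ (interchange p q r t) ⟩
    ⟦ (p ∧ r) ∧ (q ∧ t) ⟧   ≡⟨ ⟦∧⟧ (p ∧ r) (q ∧ t) ⟩
    ⟦ p ∧ r ⟧ * ⟦ q ∧ t ⟧   ∎

⟦∧anyFin⟧≤sumFin : ∀ {n} b (f : Fin n → Bool) → ⟦ b ∧ anyFin f ⟧ ≤ sumFin (λ x → ⟦ b ∧ f x ⟧)
⟦∧anyFin⟧≤sumFin         false f = z≤n
⟦∧anyFin⟧≤sumFin {zero}  true  f = z≤n
⟦∧anyFin⟧≤sumFin {suc n} true  f with f zero
... | true  = s≤s z≤n
... | false = ⟦∧anyFin⟧≤sumFin true (f ∘ suc)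

-- Counting orientations

Event : ℕ → Set
Event m = (Fin m → Bool) → Bool

⟦⟧-mono : ∀ {a b} → (T a → T b) → ⟦ a ⟧ ≤ ⟦ b ⟧
⟦⟧-mono {false}         a⇒b = z≤n
⟦⟧-mono {true}  {true}  a⇒b = ≤-refl
⟦⟧-mono {true}  {false} a⇒b = ⊥-elim (a⇒b tt)

⟦⟧-∪ : ∀ {r a b} → (T r → T a ⊎ T b) → ⟦ r ⟧ ≤ ⟦ a ⟧ + ⟦ b ⟧
⟦⟧-∪ {false} r⇒a∪b = z≤n
⟦⟧-∪ {true} {a} {b} r⇒a∪b with r⇒a∪b tt
... | inj₁ Ta = ≤-trans (⟦⟧-mono {true} {a} (λ _ → Ta)) (m≤m+n ⟦ a ⟧ ⟦ b ⟧)
... | inj₂ Tb = ≤-trans (⟦⟧-mono {true} {b} (λ _ → Tb)) (m≤n+m ⟦ b ⟧ ⟦ a ⟧)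

countAssignments-mono : ∀ m {P Q : Event m} → (∀ σ → T (P σ) → T (Q σ)) →
  countAssignments m P ≤ countAssignments m Q
countAssignments-mono zero    P⇒Q = ⟦⟧-mono (P⇒Q _)
countAssignments-mono (suc m) P⇒Q =
  +-mono-≤ (countAssignments-mono m (λ σ → P⇒Q _)) (countAssignments-mono m (λ σ → P⇒Q _))

countAssignments-false : ∀ m → countAssignments m (λ _ → false) ≡ 0
countAssignments-false zero    = refl
countAssignments-false (suc m) = cong₂ _+_ (countAssignments-false m) (countAssignments-false m)

countAssignments-∪ : ∀ m {R P Q : Event m} → (∀ σ → T (R σ) → T (P σ) ⊎ T (Q σ)) →
  countAssignments m R ≤ countAssignments m P + countAssignments m Q
countAssignments-∪ zero    R⇒P∪Q = ⟦⟧-∪ (R⇒P∪Q _)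
countAssignments-∪ (suc m) {R} {P} {Q} R⇒P∪Q = split _ _
  where
  split : (fT fF : (Fin m → Bool) → Fin (suc m) → Bool) →
    countAssignments m (R ∘ fT) + countAssignments m (R ∘ fF) ≤
    (countAssignments m (P ∘ fT) + countAssignments m (P ∘ fF)) + (countAssignments m (Q ∘ fT) + countAssignments m (Q ∘ fF))
  split fT fF = ≤-trans
    (+-mono-≤ (countAssignments-∪ m (R⇒P∪Q ∘ fT)) (countAssignments-∪ m (R⇒P∪Q ∘ fF)))
    (≤-reflexive (interchange (countAssignments m (P ∘ fT)) _ _ _))
    where
    interchange : ∀ a b c d → a + b + (c + d) ≡ a + c + (b + d)
    interchange = solve-∀

countAssignments-anyFin : ∀ m {k} {E : Fin k → Event m} {W Z} →
  (∀ i → countAssignments m (E i) * W ≤ Z) →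
  countAssignments m (λ σ → anyFin (λ i → E i σ)) * W ≤ k * Z
countAssignments-anyFin m {zero} {W = W} _ = ≤-reflexive (cong (_* W) (countAssignments-false m))
countAssignments-anyFin m {suc k} {E} {W} {Z} bound = begin
  countAssignments m (λ σ → anyFin (λ i → E i σ)) * W
    ≤⟨ *-monoˡ-≤ W (countAssignments-∪ m (λ σ → Equivalence.to T-∨)) ⟩
  (countAssignments m (E zero) + countAssignments m (λ σ → anyFin (λ i → E (suc i) σ))) * W
    ≡⟨ *-distribʳ-+ W (countAssignments m (E zero)) _ ⟩
  countAssignments m (E zero) * W + countAssignments m (λ σ → anyFin (λ i → E (suc i) σ)) * W
    ≤⟨ +-mono-≤ (bound zero) (countAssignments-anyFin m (bound ∘ suc)) ⟩
  Z + k * Z ∎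
  where
  open ≤-Reasoning

countAssignments-notAll : ∀ m n {g : Subset n → Event m} {W Z} →
  (∀ A → countAssignments m (λ σ → not (g A σ)) * W ≤ Z) →
  countAssignments m (λ σ → not (allSubsets n (λ A → g A σ))) * W ≤ 2 ^ n * Z
countAssignments-notAll m zero    {Z = Z} bound = ≤-trans (bound []) (≤-reflexive (sym (+-identityʳ Z)))
countAssignments-notAll m (suc n) {g} {W} {Z} bound = begin
  countAssignments m (λ σ → not (all inside σ ∧ all outside σ)) * W
    ≤⟨ *-monoˡ-≤ W (countAssignments-∪ m (λ σ → T-not-∧ (all inside σ))) ⟩
  (countAssignments m (λ σ → not (all inside σ)) + countAssignments m (λ σ → not (all outside σ))) * W
    ≡⟨ *-distribʳ-+ W (countAssignments m (λ σ → not (all inside σ))) _ ⟩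
  countAssignments m (λ σ → not (all inside σ)) * W + countAssignments m (λ σ → not (all outside σ)) * W
    ≤⟨ +-mono-≤ (countAssignments-notAll m n (bound ∘ (inside ∷_))) (countAssignments-notAll m n (bound ∘ (outside ∷_))) ⟩
  2 ^ n * Z + 2 ^ n * Z
    ≡⟨ double (2 ^ n) Z ⟩
  2 ^ suc n * Z ∎
  where
  open ≤-Reasoning
  all : Bool → Event m
  all s σ = allSubsets n (λ A → g (s ∷ A) σ)
  T-not-∧ : ∀ a {b} → T (not (a ∧ b)) → T (not a) ⊎ T (not b)
  T-not-∧ true  Tb = inj₂ Tb
  T-not-∧ false _  = inj₁ tt
  double : ∀ x z → x * z + x * z ≡ 2 * x * z
  double = solve-∀

countAssignments-guard : ∀ m g {P : Event m} {W Z} → (T g → countAssignments m P * W ≤ Z) →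
  countAssignments m (λ σ → g ∧ P σ) * W ≤ Z
countAssignments-guard m true  bound = bound tt
countAssignments-guard m false {W = W} _ = ≤-trans (≤-reflexive (cong (_* W) (countAssignments-false m))) z≤n

picked : ∀ {m} (x y : Fin m → Bool) → (Fin m → Bool) → ℕ
picked x y σ = sumFin (λ j → ⟦ if σ j then x j else y j ⟧)

pickable : ∀ {m} (x y : Fin m → Bool) → ℕ
pickable x y = sumFin (λ j → ⟦ x j ⟧ + ⟦ y j ⟧)

picked+picked≡pickable : ∀ {m} (x y σ : Fin m → Bool) → picked x y σ + picked y x σ ≡ pickable x y
picked+picked≡pickable x y σ =
  trans (sym (sumFin-+ (λ j → ⟦ if σ j then x j else y j ⟧) (λ j → ⟦ if σ j then y j else x j ⟧)))
        (sumFin-cong (λ j → either (σ j) (x j) (y j)))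
  where
  either : ∀ s u v → ⟦ if s then u else v ⟧ + ⟦ if s then v else u ⟧ ≡ ⟦ u ⟧ + ⟦ v ⟧
  either true  u v = refl
  either false u v = +-comm ⟦ v ⟧ ⟦ u ⟧

⟦⟧-moment : ∀ {a b c} → a + b ≤ 2 * c → a * b ≤ c * c →
  ∀ u v → a ^ ⟦ u ⟧ * b ^ ⟦ v ⟧ + a ^ ⟦ v ⟧ * b ^ ⟦ u ⟧ ≤ 2 * c ^ (⟦ u ⟧ + ⟦ v ⟧)
⟦⟧-moment {a} {b} {c} a+b≤2c ab≤c² true true =
  subst₂ _≤_ (sym (twice-product a b)) (sym (twice-square c)) (*-monoʳ-≤ 2 ab≤c²)
  where
  twice-product : ∀ a b → a * 1 * (b * 1) + a * 1 * (b * 1) ≡ 2 * (a * b)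
  twice-product = solve-∀
  twice-square : ∀ c → 2 * (c * (c * 1)) ≡ 2 * (c * c)
  twice-square = solve-∀
⟦⟧-moment {a} {b} {c} a+b≤2c ab≤c² true false = subst₂ _≤_ (sym (sum-ones a b)) (sym (double-one c)) a+b≤2c
  where
  sum-ones : ∀ a b → a * 1 * 1 + 1 * (b * 1) ≡ a + b
  sum-ones = solve-∀
  double-one : ∀ c → 2 * (c * 1) ≡ 2 * c
  double-one = solve-∀
⟦⟧-moment {a} {b} {c} a+b≤2c ab≤c² false true = subst₂ _≤_ (sym (sum-ones a b)) (sym (double-one c)) a+b≤2c
  where
  sum-ones : ∀ a b → 1 * (b * 1) + a * 1 * 1 ≡ a + b
  sum-ones = solve-∀
  double-one : ∀ c → 2 * (c * 1) ≡ 2 * c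
  double-one = solve-∀
⟦⟧-moment a+b≤2c ab≤c² false false = ≤-refl

^-split : ∀ a b α u v z z' → α * (a ^ (u + z) * b ^ (v + z')) ≡ α * (a ^ u * b ^ v) * (a ^ z * b ^ z')
^-split a b α u v z z' rewrite ^-distribˡ-+-* a u z | ^-distribˡ-+-* b v z' =
  regroup α (a ^ u) (a ^ z) (b ^ v) (b ^ z')
  where
  regroup : ∀ α p q r s → α * (p * q * (r * s)) ≡ α * (p * r) * (q * s)
  regroup = solve-∀

module _ {a b c : ℕ} (a+b≤2c : a + b ≤ 2 * c) (ab≤c² : a * b ≤ c * c) where

  -- α is the weight already contributed by the coordinates fixed so far.
  exponential-moment-scaled : ∀ m (x y : Fin m → Bool) (E : Event m) r α →
    (∀ σ → T (E σ) → r ≤ α * (a ^ picked x y σ * b ^ picked y x σ)) →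
    countAssignments m E * r ≤ α * (2 ^ m * c ^ pickable x y)
  exponential-moment-scaled zero x y E r α bound = single _ (bound _)
    where
    single : ∀ e → (T e → r ≤ α * (1 * 1)) → ⟦ e ⟧ * r ≤ α * (1 * 1)
    single true  r≤α = ≤-trans (≤-reflexive (+-identityʳ r)) (r≤α tt)
    single false _   = z≤n
  exponential-moment-scaled (suc m) x y E r α bound =
    split _ _ (λ τ e → ≤-trans (bound _ e) (≤-reflexive (^-split a b α u v _ _)))
              (λ τ e → ≤-trans (bound _ e) (≤-reflexive (^-split a b α v u _ _)))
    where
    u : ℕ
    u = ⟦ x zero ⟧
    v : ℕ
    v = ⟦ y zero ⟧
    xs : Fin m → Bool
    xs = x ∘ suc
    ys : Fin m → Bool
    ys = y ∘ suc
    M : ℕ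
    M = 2 ^ m * c ^ pickable xs ys
    split : (fT fF : (Fin m → Bool) → Fin (suc m) → Bool) →
      (∀ τ → T (E (fT τ)) → r ≤ α * (a ^ u * b ^ v) * (a ^ picked xs ys τ * b ^ picked ys xs τ)) →
      (∀ τ → T (E (fF τ)) → r ≤ α * (a ^ v * b ^ u) * (a ^ picked xs ys τ * b ^ picked ys xs τ)) →
      (countAssignments m (E ∘ fT) + countAssignments m (E ∘ fF)) * r ≤ α * (2 ^ suc m * c ^ (u + v + pickable xs ys))
    split fT fF boundT boundF = begin
      (countAssignments m (E ∘ fT) + countAssignments m (E ∘ fF)) * r
        ≡⟨ *-distribʳ-+ r (countAssignments m (E ∘ fT)) _ ⟩
      countAssignments m (E ∘ fT) * r + countAssignments m (E ∘ fF) * r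
        ≤⟨ +-mono-≤ (exponential-moment-scaled m xs ys (E ∘ fT) r (α * (a ^ u * b ^ v)) boundT)
                    (exponential-moment-scaled m xs ys (E ∘ fF) r (α * (a ^ v * b ^ u)) boundF) ⟩
      α * (a ^ u * b ^ v) * M + α * (a ^ v * b ^ u) * M
        ≡⟨ factor α (a ^ u * b ^ v) (a ^ v * b ^ u) M ⟩
      α * M * (a ^ u * b ^ v + a ^ v * b ^ u)
        ≤⟨ *-monoʳ-≤ (α * M) (⟦⟧-moment a+b≤2c ab≤c² (x zero) (y zero)) ⟩
      α * M * (2 * c ^ (u + v))
        ≡⟨ regroup α (2 ^ m) (c ^ pickable xs ys) (c ^ (u + v)) ⟩
      α * (2 ^ suc m * (c ^ (u + v) * c ^ pickable xs ys))
        ≡⟨ cong (λ t → α * (2 ^ suc m * t)) (^-distribˡ-+-* c (u + v) (pickable xs ys)) ⟨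
      α * (2 ^ suc m * c ^ (u + v + pickable xs ys)) ∎
      where
      open ≤-Reasoning
      factor : ∀ α p q x → α * p * x + α * q * x ≡ α * x * (p + q)
      factor = solve-∀
      regroup : ∀ α t s w → α * (t * s) * (2 * w) ≡ α * (2 * t * (w * s))
      regroup = solve-∀

  -- Markov's inequality for the weight a^(picked) b^(unpicked), whose average over σ is at most c^pickable.
  exponential-moment : ∀ m (x y : Fin m → Bool) {E : Event m} {r} →
    (∀ σ → T (E σ) → r ≤ a ^ picked x y σ * b ^ picked y x σ) →
    countAssignments m E * r ≤ 2 ^ m * c ^ pickable x y
  exponential-moment m x y {E} {r} bound = begin
    countAssignments m E * r        ≤⟨ exponential-moment-scaled m x y E r 1 (λ σ e → ≤-trans (bound σ e) (≤-reflexive (sym (*-identityˡ _)))) ⟩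
    1 * (2 ^ m * c ^ pickable x y)  ≡⟨ *-identityˡ _ ⟩
    2 ^ m * c ^ pickable x y        ∎
    where open ≤-Reasoning

-- Numerical inequalities

^-distrib-* : ∀ a b t → (a * b) ^ t ≡ a ^ t * b ^ t
^-distrib-* a b zero = refl
^-distrib-* a b (suc t) rewrite ^-distrib-* a b t = interchange a b (a ^ t) (b ^ t)
  where
  interchange : ∀ a b x y → a * b * (x * y) ≡ a * x * (b * y)
  interchange = solve-∀

n<2^n : ∀ n → n < 2 ^ n
n<2^n zero = s≤s z≤n
n<2^n (suc n) = begin-strict
  suc n          <⟨ s≤s (n<2^n n) ⟩
  suc (2 ^ n)    ≤⟨ +-monoˡ-≤ (2 ^ n) (m^n>0 2 n) ⟩
  2 ^ n + 2 ^ n  ≡⟨ cong (2 ^ n +_) (sym (+-identityʳ (2 ^ n))) ⟩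
  2 ^ suc n      ∎
  where open ≤-Reasoning

bernoulli : ∀ a t → a ^ t * (a + t) ≤ a * (a + 1) ^ t
bernoulli a zero = ≤-reflexive (base a)
  where
  base : ∀ a → 1 * (a + 0) ≡ a * 1
  base = solve-∀
bernoulli a (suc t) = begin
  a * a ^ t * (a + suc t)                ≤⟨ m≤m+n _ (a ^ t * t) ⟩
  a * a ^ t * (a + suc t) + a ^ t * t    ≡⟨ expand a t (a ^ t) ⟩
  (a + 1) * (a ^ t * (a + t))            ≤⟨ *-monoʳ-≤ (a + 1) (bernoulli a t) ⟩
  (a + 1) * (a * (a + 1) ^ t)            ≡⟨ *-comm-left (a + 1) a ((a + 1) ^ t) ⟩
  a * (a + 1) ^ suc t                    ∎
  where
  open ≤-Reasoning
  expand : ∀ a t x → a * x * (a + suc t) + x * t ≡ (a + 1) * (x * (a + t))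
  expand = solve-∀
  *-comm-left : ∀ a b c → a * (b * c) ≡ b * (a * c)
  *-comm-left = solve-∀

2*n^n≤[n+1]^n : ∀ n .{{_ : NonZero n}} → 2 * n ^ n ≤ (n + 1) ^ n
2*n^n≤[n+1]^n n = *-cancelˡ-≤ n (begin
  n * (2 * n ^ n)   ≡⟨ rearrange n (n ^ n) ⟩
  n ^ n * (n + n)   ≤⟨ bernoulli n n ⟩
  n * (n + 1) ^ n   ∎)
  where
  open ≤-Reasoning
  rearrange : ∀ n x → n * (2 * x) ≡ x * (n + n)
  rearrange = solve-∀

compound-growth : ∀ a .{{_ : NonZero a}} {s d X} → X ≤ 2 ^ s → a * s ≤ d → X * a ^ d ≤ (a + 1) ^ d
compound-growth a {s} {X = X} X≤2^s as≤d with m≤n⇒∃[o]m+o≡n as≤d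
... | w , refl = begin
  X * a ^ (a * s + w)                    ≡⟨ cong (X *_) (^-distribˡ-+-* a (a * s) w) ⟩
  X * (a ^ (a * s) * a ^ w)              ≡⟨ *-assoc X _ _ ⟨
  X * a ^ (a * s) * a ^ w                ≤⟨ *-monoˡ-≤ (a ^ w) (*-monoˡ-≤ (a ^ (a * s)) X≤2^s) ⟩
  2 ^ s * a ^ (a * s) * a ^ w            ≡⟨ cong (λ z → 2 ^ s * z * a ^ w) (^-*-assoc a a s) ⟨
  2 ^ s * (a ^ a) ^ s * a ^ w            ≡⟨ cong (_* a ^ w) (^-distrib-* 2 (a ^ a) s) ⟨
  (2 * a ^ a) ^ s * a ^ w                ≤⟨ *-mono-≤ (^-monoˡ-≤ s (2*n^n≤[n+1]^n a)) (^-monoˡ-≤ w (m≤m+n a 1)) ⟩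
  ((a + 1) ^ a) ^ s * (a + 1) ^ w        ≡⟨ cong (_* (a + 1) ^ w) (^-*-assoc (a + 1) a s) ⟩
  (a + 1) ^ (a * s) * (a + 1) ^ w        ≡⟨ ^-distribˡ-+-* (a + 1) (a * s) w ⟨
  (a + 1) ^ (a * s + w)                  ∎
  where open ≤-Reasoning

-- (a+1)^t − a^t ≤ t (a+1)^(t−1), multiplied through by a + 1.
succ-pow-gap : ∀ a t → (a + 1) ^ suc t ≤ a ^ t * (a + 1) + t * (a + 1) ^ t
succ-pow-gap a zero = ≤-reflexive (base a)
  where
  base : ∀ a → (a + 1) * 1 ≡ 1 * (a + 1) + 0
  base = solve-∀
succ-pow-gap a (suc t) = begin
  (a + 1) * (a + 1) ^ suc t                                  ≤⟨ *-monoʳ-≤ (a + 1) (succ-pow-gap a t) ⟩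
  (a + 1) * (x * (a + 1) + t * y)                            ≡⟨ expand a t x y ⟩
  a * x * (a + 1) + t * ((a + 1) * y) + x * (a + 1)          ≤⟨ +-monoʳ-≤ (a * x * (a + 1) + t * ((a + 1) * y)) x[a+1]≤[a+1]y ⟩
  a * x * (a + 1) + t * ((a + 1) * y) + (a + 1) * y          ≡⟨ collect a t x y ⟩
  a * x * (a + 1) + suc t * ((a + 1) * y)                    ∎
  where
  open ≤-Reasoning
  x : ℕ
  x = a ^ t
  y : ℕ
  y = (a + 1) ^ t
  x[a+1]≤[a+1]y : x * (a + 1) ≤ (a + 1) * y
  x[a+1]≤[a+1]y = subst (x * (a + 1) ≤_) (*-comm y (a + 1)) (*-monoˡ-≤ (a + 1) (^-monoˡ-≤ t (m≤m+n a 1)))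
  expand : ∀ a t x y → (a + 1) * (x * (a + 1) + t * y) ≡ a * x * (a + 1) + t * ((a + 1) * y) + x * (a + 1)
  expand = solve-∀
  collect : ∀ a t x y → a * x * (a + 1) + t * ((a + 1) * y) + (a + 1) * y ≡ a * x * (a + 1) + suc t * ((a + 1) * y)
  collect = solve-∀

K[K+2]+1≡[K+1]² : ∀ K → K * (K + 2) + 1 ≡ (K + 1) * (K + 1)
K[K+2]+1≡[K+1]² = solve-∀

gain-per-step : ∀ K → let R = (K + 1) * (K + 1); A = K * (K + 2); Q = R * (K + 1) in
  (Q + 1) * (R ^ K * (K + 1)) ≤ Q * (A ^ K * (K + 2))
gain-per-step K = +-cancelʳ-≤ (c * K * x) _ _ (subst₂ _≤_ (lhs K x) (rhs K x z) (*-monoʳ-≤ c gap))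
  where
  R : ℕ
  R = (K + 1) * (K + 1)
  A : ℕ
  A = K * (K + 2)
  x : ℕ
  x = R ^ K
  z : ℕ
  z = A ^ K
  c : ℕ
  c = (K + 1) * (K + 2)
  gap : R * x ≤ z * R + K * x
  gap = subst (λ r → r ^ suc K ≤ z * r + K * r ^ K) (K[K+2]+1≡[K+1]² K) (succ-pow-gap A K)
  lhs : ∀ K x → (K + 1) * (K + 2) * ((K + 1) * (K + 1) * x)
              ≡ ((K + 1) * (K + 1) * (K + 1) + 1) * (x * (K + 1)) + (K + 1) * (K + 2) * K * x
  lhs = solve-∀
  rhs : ∀ K x z → (K + 1) * (K + 2) * (z * ((K + 1) * (K + 1)) + K * x)
                ≡ (K + 1) * (K + 1) * (K + 1) * (z * (K + 2)) + (K + 1) * (K + 2) * K * x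
  rhs = solve-∀

^-ratio : ∀ X {u v s t} d .{{_ : NonZero u}} → X * u ^ d ≤ v ^ d → v * s ≤ u * t → X * s ^ d ≤ t ^ d
^-ratio X {u} {v} {s} {t} d Xu^d≤v^d vs≤ut = *-cancelʳ-≤ _ _ (u ^ d) {{m^n≢0 u d}} (begin
  X * s ^ d * u ^ d    ≡⟨ swap X (s ^ d) (u ^ d) ⟩
  X * u ^ d * s ^ d    ≤⟨ *-monoˡ-≤ (s ^ d) Xu^d≤v^d ⟩
  v ^ d * s ^ d        ≡⟨ ^-distrib-* v s d ⟨
  (v * s) ^ d          ≤⟨ ^-monoˡ-≤ d vs≤ut ⟩
  (u * t) ^ d          ≡⟨ ^-distrib-* u t d ⟩
  u ^ d * t ^ d        ≡⟨ *-comm (u ^ d) (t ^ d) ⟩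
  t ^ d * u ^ d        ∎)
  where
  open ≤-Reasoning
  swap : ∀ a b c → a * b * c ≡ a * c * b
  swap = solve-∀

^-trade : ∀ X {R A s t} y u .{{_ : NonZero R}} → A ≤ R →
  X * R ^ (y + u) * s ≤ A ^ (y + u) * t → X * R ^ y * s ≤ A ^ y * t
^-trade X {R} {A} {s} {t} y u A≤R hyp = *-cancelʳ-≤ _ _ (R ^ u) {{m^n≢0 R u}} (begin
  X * R ^ y * s * R ^ u      ≡⟨ split X (R ^ y) s (R ^ u) ⟩
  X * (R ^ y * R ^ u) * s    ≡⟨ cong (λ r → X * r * s) (^-distribˡ-+-* R y u) ⟨
  X * R ^ (y + u) * s        ≤⟨ hyp ⟩
  A ^ (y + u) * t            ≡⟨ cong (_* t) (^-distribˡ-+-* A y u) ⟩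
  A ^ y * A ^ u * t          ≤⟨ *-monoˡ-≤ t (*-monoʳ-≤ (A ^ y) (^-monoˡ-≤ u A≤R)) ⟩
  A ^ y * R ^ u * t          ≡⟨ swap (A ^ y) (R ^ u) t ⟩
  A ^ y * t * R ^ u          ∎)
  where
  open ≤-Reasoning
  split : ∀ a b c d → a * b * c * d ≡ a * (b * d) * c
  split = solve-∀
  swap : ∀ a b c → a * b * c ≡ a * c * b
  swap = solve-∀

-- With x = y + d, (K+2)^x K^y / (K+1)^(x+y) = (K(K+2)/(K+1)^2)^y ((K+2)/(K+1))^d; as y ≤ K d this is
-- at least ((K(K+2)/(K+1)^2)^K (K+2)/(K+1))^d ≥ (1 + 1/(K+1)^3)^d ≥ X.
drift-bound : ∀ K {X d y} → y ≤ K * d →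
  X * ((K + 1) * (K + 1) * (K + 1)) ^ d ≤ ((K + 1) * (K + 1) * (K + 1) + 1) ^ d →
  (K + 1) ^ (y + d + y) * X ≤ (K + 2) ^ (y + d) * K ^ y
drift-bound K {X} {d} {y} y≤Kd growth with m≤n⇒∃[o]m+o≡n y≤Kd
... | u , y+u≡Kd = begin
  (K + 1) ^ (y + d + y) * X          ≡⟨ cong (_* X) (^-distribˡ-+-* (K + 1) (y + d) y) ⟩
  (K + 1) ^ (y + d) * (K + 1) ^ y * X ≡⟨ cong (λ t → t * (K + 1) ^ y * X) (^-distribˡ-+-* (K + 1) y d) ⟩
  (K + 1) ^ y * (K + 1) ^ d * (K + 1) ^ y * X ≡⟨ gather ((K + 1) ^ y) ((K + 1) ^ d) X ⟩
  X * ((K + 1) ^ y * (K + 1) ^ y) * (K + 1) ^ d ≡⟨ cong (λ t → X * t * (K + 1) ^ d) (^-distrib-* (K + 1) (K + 1) y) ⟨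
  X * R ^ y * (K + 1) ^ d            ≤⟨ ^-trade X y u A≤R per-drift ⟩
  A ^ y * (K + 2) ^ d                ≡⟨ cong (_* (K + 2) ^ d) (^-distrib-* K (K + 2) y) ⟩
  K ^ y * (K + 2) ^ y * (K + 2) ^ d  ≡⟨ rotate (K ^ y) ((K + 2) ^ y) ((K + 2) ^ d) ⟩
  (K + 2) ^ y * (K + 2) ^ d * K ^ y  ≡⟨ cong (_* K ^ y) (^-distribˡ-+-* (K + 2) y d) ⟨
  (K + 2) ^ (y + d) * K ^ y          ∎
  where
  open ≤-Reasoning
  R : ℕ
  R = (K + 1) * (K + 1)
  A : ℕ
  A = K * (K + 2)
  instance
    K+1≢0 : NonZero (K + 1)
    K+1≢0 = >-nonZero (m≤n+m 1 K)
    R≢0 : NonZero R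
    R≢0 = m*n≢0 (K + 1) (K + 1)
  A≤R : A ≤ R
  A≤R = subst (A ≤_) (K[K+2]+1≡[K+1]² K) (m≤m+n A 1)
  ^-Kd : ∀ b c → (b ^ K * c) ^ d ≡ b ^ (y + u) * c ^ d
  ^-Kd b c = begin-equality
    (b ^ K * c) ^ d       ≡⟨ ^-distrib-* (b ^ K) c d ⟩
    (b ^ K) ^ d * c ^ d   ≡⟨ cong (_* c ^ d) (^-*-assoc b K d) ⟩
    b ^ (K * d) * c ^ d   ≡⟨ cong (λ t → b ^ t * c ^ d) y+u≡Kd ⟨
    b ^ (y + u) * c ^ d   ∎
  per-drift : X * R ^ (y + u) * (K + 1) ^ d ≤ A ^ (y + u) * (K + 2) ^ d
  per-drift = begin
    X * R ^ (y + u) * (K + 1) ^ d       ≡⟨ *-assoc X _ _ ⟩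
    X * (R ^ (y + u) * (K + 1) ^ d)     ≡⟨ cong (X *_) (^-Kd R (K + 1)) ⟨
    X * (R ^ K * (K + 1)) ^ d           ≤⟨ ^-ratio X {u = R * (K + 1)} d {{m*n≢0 R (K + 1)}} growth (gain-per-step K) ⟩
    (A ^ K * (K + 2)) ^ d               ≡⟨ ^-Kd A (K + 2) ⟩
    A ^ (y + u) * (K + 2) ^ d           ∎
  gather : ∀ a b c → a * b * a * c ≡ c * (a * a) * b
  gather = solve-∀
  rotate : ∀ a b c → a * b * c ≡ b * c * a
  rotate = solve-∀

≤-from-cubes : ∀ M n P → M * M * M ≤ n → n * n * (n * n) ≤ P * P * P → M * n ≤ P
≤-from-cubes M n P M³≤n n⁴≤P³ = ≮⇒≥ λ P<Mn → <⇒≱ (cube-mono P<Mn) (begin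
  M * n * (M * n) * (M * n)   ≡⟨ regroup M n ⟩
  M * M * M * (n * n * n)     ≤⟨ *-monoˡ-≤ (n * n * n) M³≤n ⟩
  n * (n * n * n)             ≡⟨ *-assoc-4 n ⟩
  n * n * (n * n)             ≤⟨ n⁴≤P³ ⟩
  P * P * P                   ∎)
  where
  open ≤-Reasoning
  cube-mono : ∀ {a b} → a < b → a * a * a < b * b * b
  cube-mono a<b = *-mono-< (*-mono-< a<b a<b) a<b
  regroup : ∀ M n → M * n * (M * n) * (M * n) ≡ M * M * M * (n * n * n)
  regroup = solve-∀
  *-assoc-4 : ∀ n → n * (n * n * n) ≡ n * n * (n * n)
  *-assoc-4 = solve-∀

drift-from-deviation : ∀ {K p P x y} → 1 ≤ p → K * (x + y) + p * P < 2 * K * x →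
  ∃[ d ] (y + d ≡ x × P < K * d)
drift-from-deviation {K} {p} {P} {x} {y} 1≤p deviation = d , y+d≡x , P<Kd
  where
  Ky+P<Kx : K * y + P < K * x
  Ky+P<Kx = +-cancelˡ-< (K * x) _ _ (begin-strict
    K * x + (K * y + P)        ≤⟨ +-monoʳ-≤ (K * x) (+-monoʳ-≤ (K * y) (m≤n*m P p {{>-nonZero 1≤p}})) ⟩
    K * x + (K * y + p * P)    ≡⟨ regroup K x y (p * P) ⟩
    K * (x + y) + p * P        <⟨ deviation ⟩
    2 * K * x                  ≡⟨ double K x ⟩
    K * x + K * x              ∎)
    where
    open ≤-Reasoning
    regroup : ∀ K x y z → K * x + (K * y + z) ≡ K * (x + y) + z
    regroup = solve-∀
    double : ∀ K x → 2 * K * x ≡ K * x + K * x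
    double = solve-∀
  y≤x : y ≤ x
  y≤x = <⇒≤ (*-cancelˡ-< K y x (≤-<-trans (m≤m+n (K * y) P) Ky+P<Kx))
  d : ℕ
  d = proj₁ (m≤n⇒∃[o]m+o≡n y≤x)
  y+d≡x : y + d ≡ x
  y+d≡x = proj₂ (m≤n⇒∃[o]m+o≡n y≤x)
  P<Kd : P < K * d
  P<Kd = +-cancelˡ-< (K * y) _ _ (subst (K * y + P <_) (trans (cong (K *_) (sym y+d≡x)) (*-distribˡ-+ K y d)) Ky+P<Kx)

drift-scale : ℕ → ℕ
drift-scale K = 3 * K * ((K + 1) * (K + 1) * (K + 1))

-- n ≥ threshold K gives 2K ≤ n and, for sets of size at least n^(2/3), |A||B| ≥ drift-scale K · n.
threshold : ℕ → ℕ
threshold K = drift-scale K * drift-scale K * drift-scale K + 2 * K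

-- For K = kq: the 4^n · 2 · k events of the union bound, times q.
budget : ℕ → ℕ → ℕ
budget n K = 2 ^ n * (2 ^ n * (2 * K))

deviation-bound : ∀ {K p n P x y} → 1 ≤ p → threshold K ≤ n → n * n * (n * n) ≤ P * P * P →
  x + y ≤ P → K * (x + y) + p * P < 2 * K * x →
  (K + 1) ^ (x + y) * budget n K ≤ (K + 2) ^ x * K ^ y
deviation-bound {K} {p} {n} {P} {x} {y} 1≤p N≤n n⁴≤P³ x+y≤P deviation
  with drift-from-deviation {K} {p} {P} {x} {y} 1≤p deviation
... | d , refl , P<Kd = drift-bound K y≤Kd (compound-growth Q budget≤2^3n 3nQ≤d)
  where
  Q : ℕ
  Q = (K + 1) * (K + 1) * (K + 1)
  instance
    K+1≢0 : NonZero (K + 1)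
    K+1≢0 = >-nonZero (m≤n+m 1 K)
    Q≢0 : NonZero Q
    Q≢0 = m*n≢0 ((K + 1) * (K + 1)) (K + 1) {{m*n≢0 (K + 1) (K + 1)}}
  y≤Kd : y ≤ K * d
  y≤Kd = ≤-trans (m≤n+m y (y + d)) (≤-trans x+y≤P (<⇒≤ P<Kd))
  2K≤n : 2 * K ≤ n
  2K≤n = ≤-trans (m≤n+m (2 * K) (drift-scale K * drift-scale K * drift-scale K)) N≤n
  budget≤2^3n : budget n K ≤ 2 ^ (n + (n + n))
  budget≤2^3n = begin
    2 ^ n * (2 ^ n * (2 * K))      ≤⟨ *-monoʳ-≤ (2 ^ n) (*-monoʳ-≤ (2 ^ n) (≤-trans 2K≤n (<⇒≤ (n<2^n n)))) ⟩
    2 ^ n * (2 ^ n * 2 ^ n)        ≡⟨ cong (2 ^ n *_) (^-distribˡ-+-* 2 n n) ⟨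
    2 ^ n * 2 ^ (n + n)            ≡⟨ ^-distribˡ-+-* 2 n (n + n) ⟨
    2 ^ (n + (n + n))              ∎
    where open ≤-Reasoning
  3nQ≤d : Q * (n + (n + n)) ≤ d
  3nQ≤d = <⇒≤ (*-cancelˡ-< K _ _ (begin-strict
    K * (Q * (n + (n + n)))        ≡⟨ regroup K Q n ⟩
    drift-scale K * n              ≤⟨ ≤-from-cubes (drift-scale K) n P (≤-trans (m≤m+n _ (2 * K)) N≤n) n⁴≤P³ ⟩
    P                              <⟨ P<Kd ⟩
    K * d                          ∎))
    where
    open ≤-Reasoning
    regroup : ∀ K Q n → K * (Q * (n + (n + n))) ≡ 3 * K * Q * n
    regroup = solve-∀

-- Arcs between two vertex sets

module Orientation {n k m} (C : Fin m → Fin k → Fin n) (A B : Subset n) where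

  inA : Fin n → Bool
  inA u = ⌊ u ∈? A ⌋

  inB : Fin n → Bool
  inB u = ⌊ u ∈? B ⌋

  -- forward i j (backward i j): the i-th edge of cycle j is an arc A → B if cycle j is oriented
  -- forward (backward).
  forward : Fin k → Fin m → Bool
  forward i j = inA (C j i) ∧ inB (C j (cnext i))

  backward : Fin k → Fin m → Bool
  backward i j = inA (C j (cnext i)) ∧ inB (C j i)

  arcs : Fin k → (Fin m → Bool) → ℕ
  arcs i = picked (forward i) (backward i)

  edges : Fin k → ℕ
  edges i = pickable (forward i) (backward i)

  e≤sumFin-arcs : ∀ σ → e C σ A B ≤ sumFin (λ i → arcs i σ)
  e≤sumFin-arcs σ = begin
    e C σ A B
      ≡⟨ sumFin-cong (λ u → countFin≡sumFin (λ v → inA u ∧ inB v ∧ arc C σ u v)) ⟩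
    sumFin (λ u → sumFin (λ v → ⟦ inA u ∧ inB v ∧ arc C σ u v ⟧))
      ≤⟨ sumFin-mono (λ u → sumFin-mono (λ v → arc≤sumFin u v)) ⟩
    sumFin (λ u → sumFin (λ v → sumFin (λ j → sumFin (λ i → ⟦ (inA u ∧ inB v) ∧ oriented j i u v ⟧))))
      ≡⟨ sumFin-swap₂ (λ u v j i → ⟦ (inA u ∧ inB v) ∧ oriented j i u v ⟧) ⟩
    sumFin (λ j → sumFin (λ i → sumFin (λ u → sumFin (λ v → ⟦ (inA u ∧ inB v) ∧ oriented j i u v ⟧))))
      ≡⟨ sumFin-cong (λ j → sumFin-cong (λ i → locate (σ j) j i)) ⟩
    sumFin (λ j → sumFin (λ i → ⟦ if σ j then forward i j else backward i j ⟧))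
      ≡⟨ sumFin-swap (λ j i → ⟦ if σ j then forward i j else backward i j ⟧) ⟩
    sumFin (λ i → arcs i σ) ∎
    where
    open ≤-Reasoning
    oriented : Fin m → Fin k → Fin n → Fin n → Bool
    oriented j i u v = if σ j then (C j i == u ∧ C j (cnext i) == v) else (C j (cnext i) == u ∧ C j i == v)
    arc≤sumFin : ∀ u v → ⟦ inA u ∧ inB v ∧ arc C σ u v ⟧ ≤
                         sumFin (λ j → sumFin (λ i → ⟦ (inA u ∧ inB v) ∧ oriented j i u v ⟧))
    arc≤sumFin u v = begin
      ⟦ inA u ∧ inB v ∧ arc C σ u v ⟧
        ≡⟨ cong ⟦_⟧ (∧-assoc (inA u) (inB v) (arc C σ u v)) ⟨
      ⟦ (inA u ∧ inB v) ∧ arc C σ u v ⟧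
        ≤⟨ ⟦∧anyFin⟧≤sumFin (inA u ∧ inB v) (λ j → anyFin (λ i → oriented j i u v)) ⟩
      sumFin (λ j → ⟦ (inA u ∧ inB v) ∧ anyFin (λ i → oriented j i u v) ⟧)
        ≤⟨ sumFin-mono (λ j → ⟦∧anyFin⟧≤sumFin (inA u ∧ inB v) (λ i → oriented j i u v)) ⟩
      sumFin (λ j → sumFin (λ i → ⟦ (inA u ∧ inB v) ∧ oriented j i u v ⟧)) ∎
    locate : ∀ s j i →
      sumFin (λ u → sumFin (λ v → ⟦ (inA u ∧ inB v) ∧
        (if s then (C j i == u ∧ C j (cnext i) == v) else (C j (cnext i) == u ∧ C j i == v)) ⟧))
      ≡ ⟦ if s then forward i j else backward i j ⟧
    locate true  j i = sumFin²-delta inA inB (C j i) (C j (cnext i))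
    locate false j i = sumFin²-delta inA inB (C j (cnext i)) (C j i)

  tooManyArcs : ℕ → ℕ → Event m
  tooManyArcs p q σ = not (2 * q * e C σ A B ≤ᵇ (q + p) * (∣ A ∣ * ∣ B ∣))

  deviates : ℕ → ℕ → Fin k → Event m
  deviates p q i σ = not (2 * (k * q) * arcs i σ ≤ᵇ k * q * edges i + p * (∣ A ∣ * ∣ B ∣))

  edgeAt : Fin m → Fin k → Fin n → Fin n → Bool
  edgeAt j i = edgeIs (C j i) (C j (cnext i))

  module _ (disjoint : ∀ x → ¬ T (inA x ∧ inB x)) (D : IsCkDecomposition C) where

    endpoints≤sumFin : ∀ i j → ⟦ forward i j ⟧ + ⟦ backward i j ⟧ ≤
      sumFin (λ u → sumFin (λ v → ⟦ (inA u ∧ inB v) ∧ edgeAt j i u v ⟧))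
    endpoints≤sumFin i j = exclusive-sum (forward i j) (backward i j) not-both
      (begin
        ⟦ inA a ∧ inB b ⟧
          ≡⟨ sumFin²-delta inA inB a b ⟨
        sumFin (λ u → sumFin (λ v → ⟦ (inA u ∧ inB v) ∧ (a == u ∧ b == v) ⟧))
          ≤⟨ sumFin-mono (λ u → sumFin-mono (λ v → weakenˡ (inA u ∧ inB v) (a == u ∧ b == v) _)) ⟩
        sumFin (λ u → sumFin (λ v → ⟦ (inA u ∧ inB v) ∧ edgeAt j i u v ⟧)) ∎)
      (begin
        ⟦ inA b ∧ inB a ⟧
          ≡⟨ sumFin²-delta inA inB b a ⟨
        sumFin (λ u → sumFin (λ v → ⟦ (inA u ∧ inB v) ∧ (b == u ∧ a == v) ⟧))
          ≡⟨ sumFin-cong (λ u → sumFin-cong (λ v → cong (λ t → ⟦ (inA u ∧ inB v) ∧ t ⟧) (∧-comm (b == u) (a == v)))) ⟩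
        sumFin (λ u → sumFin (λ v → ⟦ (inA u ∧ inB v) ∧ (a == v ∧ b == u) ⟧))
          ≤⟨ sumFin-mono (λ u → sumFin-mono (λ v → weakenʳ (inA u ∧ inB v) (a == u ∧ b == v) _)) ⟩
        sumFin (λ u → sumFin (λ v → ⟦ (inA u ∧ inB v) ∧ edgeAt j i u v ⟧)) ∎)
      where
      open ≤-Reasoning
      a : Fin n
      a = C j i
      b : Fin n
      b = C j (cnext i)
      not-both : T (forward i j) → T (backward i j) → ⊥
      not-both fw bw = disjoint a (Equivalence.from (T-∧ {inA a} {inB a})
        (proj₁ (Equivalence.to (T-∧ {inA a} {inB b}) fw) , proj₂ (Equivalence.to (T-∧ {inA b} {inB a}) bw)))
      exclusive-sum : ∀ f g {t} → (T f → T g → ⊥) → ⟦ f ⟧ ≤ t → ⟦ g ⟧ ≤ t → ⟦ f ⟧ + ⟦ g ⟧ ≤ t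
      exclusive-sum true  true  excl _   _   = ⊥-elim (excl tt tt)
      exclusive-sum true  false excl f≤t _   = f≤t
      exclusive-sum false g     excl _   g≤t = g≤t
      weakenˡ : ∀ x p q → ⟦ x ∧ p ⟧ ≤ ⟦ x ∧ (p ∨ q) ⟧
      weakenˡ false p     q = z≤n
      weakenˡ true  true  q = ≤-refl
      weakenˡ true  false q = z≤n
      weakenʳ : ∀ x p q → ⟦ x ∧ q ⟧ ≤ ⟦ x ∧ (p ∨ q) ⟧
      weakenʳ x p q = subst (λ t → ⟦ x ∧ q ⟧ ≤ ⟦ x ∧ t ⟧) (∨-comm q p) (weakenˡ x q p)

    edges≤⟦∈A⟧*⟦∈B⟧ : ∀ u v → sumFin (λ j → sumFin (λ i → ⟦ (inA u ∧ inB v) ∧ edgeAt j i u v ⟧)) ≤ ⟦ inA u ⟧ * ⟦ inB v ⟧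
    edges≤⟦∈A⟧*⟦∈B⟧ u v = ≤-trans (guarded (inA u ∧ inB v) unique) (≤-reflexive (⟦∧⟧ (inA u) (inB v)))
      where
      unique : T (inA u ∧ inB v) → sumFin (λ j → sumFin (λ i → ⟦ edgeAt j i u v ⟧)) ≡ 1
      unique u∈A∧v∈B = trans (sumFin-cong (λ j → sym (countFin≡sumFin (λ i → edgeAt j i u v)))) (proj₂ D u v u≢v)
        where
        u≢v : u ≢ v
        u≢v refl = disjoint u u∈A∧v∈B
      guarded : ∀ g → (T g → sumFin (λ j → sumFin (λ i → ⟦ edgeAt j i u v ⟧)) ≡ 1) →
        sumFin (λ j → sumFin (λ i → ⟦ g ∧ edgeAt j i u v ⟧)) ≤ ⟦ g ⟧
      guarded true  sum≡1 = ≤-reflexive (sum≡1 tt)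
      guarded false _     = ≤-reflexive (sumFin-zero {m} (λ j → sumFin-zero {k} (λ i → refl)))

    sumFin-edges≤∣A∣*∣B∣ : sumFin edges ≤ ∣ A ∣ * ∣ B ∣
    sumFin-edges≤∣A∣*∣B∣ = begin
      sumFin (λ i → sumFin (λ j → ⟦ forward i j ⟧ + ⟦ backward i j ⟧))
        ≡⟨ sumFin-swap (λ i j → ⟦ forward i j ⟧ + ⟦ backward i j ⟧) ⟩
      sumFin (λ j → sumFin (λ i → ⟦ forward i j ⟧ + ⟦ backward i j ⟧))
        ≤⟨ sumFin-mono (λ j → sumFin-mono (λ i → endpoints≤sumFin i j)) ⟩
      sumFin (λ j → sumFin (λ i → sumFin (λ u → sumFin (λ v → ⟦ (inA u ∧ inB v) ∧ edgeAt j i u v ⟧))))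
        ≡⟨ sumFin-swap₂ (λ j i u v → ⟦ (inA u ∧ inB v) ∧ edgeAt j i u v ⟧) ⟩
      sumFin (λ u → sumFin (λ v → sumFin (λ j → sumFin (λ i → ⟦ (inA u ∧ inB v) ∧ edgeAt j i u v ⟧))))
        ≤⟨ sumFin-mono (λ u → sumFin-mono (λ v → edges≤⟦∈A⟧*⟦∈B⟧ u v)) ⟩
      sumFin (λ u → sumFin (λ v → ⟦ inA u ⟧ * ⟦ inB v ⟧))
        ≡⟨ sumFin-*-sumFin (⟦_⟧ ∘ inA) (⟦_⟧ ∘ inB) ⟩
      sumFin (⟦_⟧ ∘ inA) * sumFin (⟦_⟧ ∘ inB)
        ≡⟨ cong₂ _*_ (∣A∣≡sumFin A) (∣A∣≡sumFin B) ⟨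
      ∣ A ∣ * ∣ B ∣ ∎
      where open ≤-Reasoning

    module _ (p q : ℕ) (1≤p : 1 ≤ p) where

      K : ℕ
      K = k * q

      deviation-somewhere : .{{_ : NonZero k}} → ∀ σ → T (tooManyArcs p q σ) → T (anyFin (λ i → deviates p q i σ))
      deviation-somewhere σ tooMany with T? (anyFin (λ i → deviates p q i σ))
      ... | yes some = some
      ... | no none  = ⊥-elim (<⇒≱ (T-not-≤ᵇ⇒> tooMany) (*-cancelˡ-≤ k (begin
        k * (2 * q * e C σ A B)                       ≡⟨ regroup k q (e C σ A B) ⟩
        2 * K * e C σ A B                             ≤⟨ *-monoʳ-≤ (2 * K) (e≤sumFin-arcs σ) ⟩
        2 * K * sumFin (λ i → arcs i σ)               ≡⟨ sumFin-*ˡ (2 * K) (λ i → arcs i σ) ⟨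
        sumFin (λ i → 2 * K * arcs i σ)               ≤⟨ sumFin-mono {k} (λ i → ¬T-not-≤ᵇ⇒≤ (¬T-anyFin (λ i → deviates p q i σ) none i)) ⟩
        sumFin (λ i → K * edges i + p * P)            ≡⟨ sumFin-+ (λ i → K * edges i) (λ _ → p * P) ⟩
        sumFin (λ i → K * edges i) + sumFin {k} (λ _ → p * P)
                                                      ≡⟨ cong₂ _+_ (sumFin-*ˡ K edges) (sumFin-const k (p * P)) ⟩
        K * sumFin edges + k * (p * P)                ≤⟨ +-monoˡ-≤ (k * (p * P)) (*-monoʳ-≤ K sumFin-edges≤∣A∣*∣B∣) ⟩
        K * P + k * (p * P)                           ≡⟨ collect k q p P ⟩
        k * ((q + p) * P)                             ∎)))
        where
        open ≤-Reasoning
        P : ℕ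
        P = ∣ A ∣ * ∣ B ∣
        regroup : ∀ k q e → k * (2 * q * e) ≡ 2 * (k * q) * e
        regroup = solve-∀
        collect : ∀ k q p P → k * q * P + k * (p * P) ≡ k * ((q + p) * P)
        collect = solve-∀

      module _ (N≤n : threshold K ≤ n) (n⁴≤P³ : n * n * (n * n) ≤ (∣ A ∣ * ∣ B ∣) * (∣ A ∣ * ∣ B ∣) * (∣ A ∣ * ∣ B ∣)) where

        position-bound : ∀ i → countAssignments m (deviates p q i) * (budget n K) ≤ 2 ^ m
        position-bound i = *-cancelʳ-≤ _ _ ((K + 1) ^ edges i) {{m^n≢0 (K + 1) (edges i)}} (begin
          countAssignments m (deviates p q i) * (budget n K) * (K + 1) ^ edges i    ≡⟨ swap (countAssignments m (deviates p q i)) (budget n K) _ ⟩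
          countAssignments m (deviates p q i) * ((K + 1) ^ edges i * (budget n K))  ≤⟨ exponential-moment a+b≤2c ab≤c² m (forward i) (backward i) weight ⟩
          2 ^ m * (K + 1) ^ edges i                                  ∎)
          where
          open ≤-Reasoning
          instance
            K+1≢0 : NonZero (K + 1)
            K+1≢0 = >-nonZero (m≤n+m 1 K)
          a+b≤2c : K + 2 + K ≤ 2 * (K + 1)
          a+b≤2c = ≤-reflexive (double K)
            where
            double : ∀ K → K + 2 + K ≡ 2 * (K + 1)
            double = solve-∀
          ab≤c² : (K + 2) * K ≤ (K + 1) * (K + 1)
          ab≤c² = subst (_≤ (K + 1) * (K + 1)) (*-comm K (K + 2))
                    (subst (K * (K + 2) ≤_) (K[K+2]+1≡[K+1]² K) (m≤m+n _ 1))
          swap : ∀ c x y → c * x * y ≡ c * (y * x)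
          swap = solve-∀
          weight : ∀ σ → T (deviates p q i σ) →
            (K + 1) ^ edges i * (budget n K) ≤ (K + 2) ^ arcs i σ * K ^ picked (backward i) (forward i) σ
          weight σ dev = subst (λ t → (K + 1) ^ t * (budget n K) ≤ (K + 2) ^ x * K ^ y) (sym x+y≡S)
            (deviation-bound {K} {p} {n} {∣ A ∣ * ∣ B ∣} {x} {y} 1≤p N≤n n⁴≤P³ x+y≤P
              (subst (λ t → K * t + p * (∣ A ∣ * ∣ B ∣) < 2 * K * x) x+y≡S (T-not-≤ᵇ⇒> dev)))
            where
            x : ℕ
            x = arcs i σ
            y : ℕ
            y = picked (backward i) (forward i) σ
            x+y≡S : edges i ≡ x + y
            x+y≡S = sym (picked+picked≡pickable (forward i) (backward i) σ)
            x+y≤P : x + y ≤ ∣ A ∣ * ∣ B ∣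
            x+y≤P = subst (_≤ ∣ A ∣ * ∣ B ∣) x+y≡S (≤-trans (f≤sumFin edges i) sumFin-edges≤∣A∣*∣B∣)

        direction-bound : .{{_ : NonZero k}} → countAssignments m (tooManyArcs p q) * (budget n K) ≤ k * 2 ^ m
        direction-bound = ≤-trans (*-monoˡ-≤ (budget n K) (countAssignments-mono m deviation-somewhere))
                                  (countAssignments-anyFin m position-bound)

-- The union bound over all pairs

disjointB⇒¬T-∈∧∈ : ∀ {n} {A B : Subset n} → T (disjointB A B) → ∀ x → ¬ T (⌊ x ∈? A ⌋ ∧ ⌊ x ∈? B ⌋)
disjointB⇒¬T-∈∧∈ A∩B≡∅ = ¬T-anyFin _ (T-not⇒¬T A∩B≡∅)

disjointB-sym : ∀ {n} {A B : Subset n} → T (disjointB A B) → T (disjointB B A)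
disjointB-sym {A = A} {B} = subst (T ∘ not) (anyFin-cong (λ x → ∧-comm ⌊ x ∈? A ⌋ ⌊ x ∈? B ⌋))

largeB-pair : ∀ {n} {A B : Subset n} → T (largeB A) → T (largeB B) →
  n * n * (n * n) ≤ (∣ A ∣ * ∣ B ∣) * (∣ A ∣ * ∣ B ∣) * (∣ A ∣ * ∣ B ∣)
largeB-pair {n} {A} {B} A-large B-large =
  ≤-trans (*-mono-≤ (≤ᵇ⇒≤ (n * n) (∣ A ∣ * ∣ A ∣ * ∣ A ∣) A-large) (≤ᵇ⇒≤ (n * n) (∣ B ∣ * ∣ B ∣ * ∣ B ∣) B-large))
          (≤-reflexive (regroup ∣ A ∣ ∣ B ∣))
  where
  regroup : ∀ a b → a * a * a * (b * b * b) ≡ a * b * (a * b) * (a * b)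
  regroup = solve-∀

violates⇒tooManyArcs : ∀ {n k m} (C : Fin m → Fin k → Fin n) p q A B σ → T (violates C σ p q A B) →
  T (Orientation.tooManyArcs C A B p q σ) ⊎ T (Orientation.tooManyArcs C B A p q σ)
violates⇒tooManyArcs C p q A B σ =
  [ inj₁ ∘ subst (λ t → T (not (2 * q * e C σ A B ≤ᵇ t))) (*-assoc (q + p) ∣ A ∣ ∣ B ∣)
  , inj₂ ∘ subst (λ t → T (not (2 * q * e C σ B A ≤ᵇ t))) (swap (q + p) ∣ A ∣ ∣ B ∣)
  ]′ ∘ Equivalence.to T-∨
  where
  swap : ∀ c a b → c * a * b ≡ c * (b * a)
  swap = solve-∀

module _ {n k m} (C : Fin m → Fin k → Fin n) (D : IsCkDecomposition C) (p q : ℕ) (1≤p : 1 ≤ p)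
         (N≤n : threshold (k * q) ≤ n) .{{_ : NonZero k}} where

  pair-bound : ∀ A B →
    countAssignments m (λ σ → disjointB A B ∧ largeB A ∧ largeB B ∧ violates C σ p q A B) * (budget n (k * q)) ≤ 2 * (k * 2 ^ m)
  pair-bound A B =
    countAssignments-guard m (disjointB A B) λ A∩B≡∅ →
    countAssignments-guard m (largeB A) λ A-large →
    countAssignments-guard m (largeB B) λ B-large → begin
      countAssignments m (λ σ → violates C σ p q A B) * (budget n (k * q))
        ≤⟨ *-monoˡ-≤ (budget n (k * q)) (countAssignments-∪ m (violates⇒tooManyArcs C p q A B)) ⟩
      (countAssignments m (Orientation.tooManyArcs C A B p q) + countAssignments m (Orientation.tooManyArcs C B A p q)) * (budget n (k * q))
        ≡⟨ *-distribʳ-+ (budget n (k * q)) (countAssignments m (Orientation.tooManyArcs C A B p q)) _ ⟩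
      countAssignments m (Orientation.tooManyArcs C A B p q) * (budget n (k * q)) + countAssignments m (Orientation.tooManyArcs C B A p q) * (budget n (k * q))
        ≤⟨ +-mono-≤ (Orientation.direction-bound C A B (disjointB⇒¬T-∈∧∈ A∩B≡∅) D p q 1≤p N≤n
                       (largeB-pair {A = A} {B} A-large B-large))
                    (Orientation.direction-bound C B A (disjointB⇒¬T-∈∧∈ (disjointB-sym {A = A} {B} A∩B≡∅)) D p q 1≤p N≤n
                       (largeB-pair {A = B} {A} B-large A-large)) ⟩
      k * 2 ^ m + k * 2 ^ m
        ≡⟨ cong (k * 2 ^ m +_) (+-identityʳ (k * 2 ^ m)) ⟨
      2 * (k * 2 ^ m) ∎
    where open ≤-Reasoning

  badCount-bound : badCount C p q * (budget n (k * q)) ≤ 2 ^ n * (2 ^ n * (2 * (k * 2 ^ m)))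
  badCount-bound = countAssignments-notAll m n λ A →
                   countAssignments-notAll m n λ B →
                   ≤-trans (*-monoˡ-≤ (budget n (k * q)) (countAssignments-mono m (λ σ → subst T (not-involutive _))))
                           (pair-bound A B)


  q*badCount≤2^m : q * badCount C p q ≤ 2 ^ m
  q*badCount≤2^m = *-cancelʳ-≤ _ _ Y {{Y≢0}} (begin
    q * badCount C p q * Y                 ≡⟨ regroup q (badCount C p q) (2 ^ n) k ⟩
    badCount C p q * (budget n (k * q))                     ≤⟨ badCount-bound ⟩
    2 ^ n * (2 ^ n * (2 * (k * 2 ^ m)))    ≡⟨ regroup′ k (2 ^ m) (2 ^ n) ⟩
    2 ^ m * Y                              ∎)
    where
    open ≤-Reasoning
    Y : ℕ
    Y = 2 ^ n * (2 ^ n * (2 * k))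
    Y≢0 : NonZero Y
    Y≢0 = m*n≢0 (2 ^ n) _ {{m^n≢0 2 n}} {{m*n≢0 (2 ^ n) _ {{m^n≢0 2 n}} {{m*n≢0 2 k}}}}
    regroup : ∀ q b t k → q * b * (t * (t * (2 * k))) ≡ b * (t * (t * (2 * (k * q))))
    regroup = solve-∀
    regroup′ : ∀ k s t → t * (t * (2 * (k * s))) ≡ s * (t * (t * (2 * k)))
    regroup′ = solve-∀

lemma5p2 : ∀ (k : ℕ) → 3 ≤ k → ∀ (p q : ℕ) → 1 ≤ p → 1 ≤ q →
    ∃[ N ] (∀ (n : ℕ) → N ≤ n → (∃[ t ] n ≡ suc (t * (2 * k))) →
    ∀ (m : ℕ) (C : Fin m → Fin k → Fin n) → IsCkDecomposition C →
    q * badCount C p q ≤ p * 2 ^ m)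
lemma5p2 k 3≤k p q 1≤p _ = threshold (k * q) , λ n N≤n _ m C D →
  ≤-trans (q*badCount≤2^m C D p q 1≤p N≤n {{k≢0}}) (m≤n*m (2 ^ m) p {{>-nonZero 1≤p}})
  where
  k≢0 : NonZero k
  k≢0 = >-nonZero (≤-trans (s≤s z≤n) 3≤k)
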